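{- Let $\mathcal{F}=\langle E,H,\sim\rangle$ be an ETL frame in which $\sim$ is an equivalence relation. Then $\mathcal{F}$ has perfect recall (i.e. $\mathsf{PR_{hc}}$, equivalently $\mathsf{PR_{ee}}$) if and only if $\mathcal{F}$ has $\mathsf{PR_{hc}^\ell}$.
   Context: Fix a finite set $E$ of events. A history is a finite sequence of events; $\epsilon$ is the empty history. Write $h\leadsto h'$ if $h'=he$ for some event $e$, and $\leadsto^*$ for the reflexive–transitive closure (prefix relation). A protocol $H$ is a finite prefix-closed set of histories. An ETL frame is $\langle E,H,\sim\rangle$ with $\sim\subseteq H\times H$; all histories range over $H$. $[h]_\sim=\{h':h\sim h'\}$. $\mathrm{EE}(e_1\dots e_\ell)$ is the sequence $[\epsilon]_\sim,[e_1]_\sim,\dots,[e_1\dots e_\ell]_\sim$; $\mathrm{EE}(h)\approx\mathrm{EE}(h')$ means equality after collapsing consecutive repeated sets. $\mathsf{PR_{ee}}$: $h\sim h'$ implies $\mathrm{EE}(h)\approx\mathrm{EE}(h')$. $\mathsf{PR_{hc}}$: whenever $he\sim h'$ there is $h''$ with $h\sim h''\leadsto^*h'$. $\mathsf{PR_{hc}^\ell}$: whenever $he\sim h'$, (i) $h\sim h'$, or (ii) $h\sim h''\leadsto h'$ for some $h''$, or (iii) $he\sim h''\leadsto h'$ for some $h''$. On frames with $\sim$ an equivalence relation, $\mathsf{PR_{ee}}$ and $\mathsf{PR_{hc}}$ are equivalent, and "perfect recall" refers to either. -}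

module Defs where

open import Data.List using (List; []; _∷_; _++_; _∷ʳ_)
open import Data.List.Membership.Propositional using (_∈_)
open import Data.Product using (Σ; ∃; ∃-syntax; _×_; _,_)
open import Data.Sum using (_⊎_)
open import Relation.Binary.PropositionalEquality using (_≡_)

-- Histories over an event type E are lists, read left to right;
-- the empty history ε is [] and "h e" is h ∷ʳ e.
History : Set → Set
History E = List E

_⇝_ : {E : Set} → History E → History E → Set
_⇝_ {E} h h' = ∃[ e ] (h' ≡ h ∷ʳ e)

-- reflexive-transitive closure of ⇝ = prefix relation
_⇝*_ : {E : Set} → History E → History E → Set
_⇝*_ {E} h h' = ∃[ s ] (h' ≡ h ++ s)

FiniteType : Set → Set
FiniteType A = ∃[ xs ] (∀ (a : A) → a ∈ xs)

FiniteSet : {E : Set} → (History E → Set) → Set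
FiniteSet {E} P = ∃[ xs ] (∀ (h : History E) → P h → h ∈ xs)

-- ETL frame ⟨E, H, ∼⟩ with H a protocol (finite, prefix-closed set of
-- histories; prefix-closedness also implies ε ∈ H when H is nonempty)
-- and ∼ ⊆ H × H.
record ETLFrame : Set₁ where
  field
    E         : Set
    E-finite  : FiniteType E
    H         : History E → Set
    H-finite  : FiniteSet H
    H-prefix  : ∀ (h h' : History E) → h ⇝* h' → H h' → H h
    _∼_       : History E → History E → Set
    ∼⊆H×H     : ∀ (h h' : History E) → h ∼ h' → H h × H h'

module _ (F : ETLFrame) where
  open ETLFrame F

  IsEquivalenceOnH : Set
  IsEquivalenceOnH =
      (∀ (h : History E) → H h → h ∼ h)
    × (∀ (h h' : History E) → h ∼ h' → h' ∼ h)
    × (∀ (h h' h'' : History E) → h ∼ h' → h' ∼ h'' → h ∼ h'')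

  PR-hc : Set
  PR-hc = ∀ (h : History E) (e : E) (h' : History E) →
          (h ∷ʳ e) ∼ h' →
          ∃[ h'' ] (H h'' × h ∼ h'' × h'' ⇝* h')

  PR-hcℓ : Set
  PR-hcℓ = ∀ (h : History E) (e : E) (h' : History E) →
           (h ∷ʳ e) ∼ h' →
           (h ∼ h')
           ⊎ (∃[ h'' ] (H h'' × h ∼ h'' × h'' ⇝ h'))
           ⊎ (∃[ h'' ] (H h'' × (h ∷ʳ e) ∼ h'' × h'' ⇝ h'))

-- Perfect recall makes every ∼-class convex along prefixes: if a ⇝* b ⇝* c
-- and a ∼ c then a ∼ b.  Given he ∼ h', perfect recall finds h ∼ m ⇝* h';
-- if m ≠ h' then h' = g x with m ⇝* g, and perfect recall applied to
-- g x ∼ he finds g ∼ k ⇝* he.  Either k = he, which is case (iii), or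
-- k ⇝* h, and transporting m ∼ h back along g ∼ k together with convexity
-- gives h ∼ k ∼ g, which is case (ii).  Conversely, PR_hc^ℓ yields PR_hc by
-- induction on h': cases (i) and (ii) give the witness directly and case
-- (iii) reduces he ∼ g x to he ∼ g.
module Submission where

open import Data.List using ([]; _∷_; _++_; _∷ʳ_)
open import Data.List.Properties using (++-assoc; ++-identityʳ; ∷ʳ-injectiveˡ)
open import Data.List.Reverse using (Reverse; []; _∶_∶ʳ_; reverseView)
open import Data.Product using (∃-syntax; _×_; _,_; proj₁; proj₂)
open import Data.Sum using (_⊎_; inj₁; inj₂)
open import Function.Bundles using (_⇔_; mk⇔)
open import Relation.Binary.PropositionalEquality using (_≡_; refl; sym; trans; subst)

open import Defs

module _ {E : Set} where

  ⇝*-refl : (h : History E) → h ⇝* h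
  ⇝*-refl h = [] , sym (++-identityʳ h)

  ⇝*-trans : {a b c : History E} → a ⇝* b → b ⇝* c → a ⇝* c
  ⇝*-trans {a} (s , refl) (t , refl) = s ++ t , ++-assoc a s t

  ⇝⇒⇝* : {a b : History E} → a ⇝ b → a ⇝* b
  ⇝⇒⇝* (e , refl) = e ∷ [] , refl

  ⇝*-[] : {a : History E} → a ⇝* [] → a ≡ []
  ⇝*-[] {[]}    _       = refl
  ⇝*-[] {_ ∷ _} (_ , ())

  ⇝*-∷ʳ : {a g : History E} {e : E} → a ⇝* (g ∷ʳ e) → a ≡ g ∷ʳ e ⊎ a ⇝* g
  ⇝*-∷ʳ {a} {g} (s , eq) with reverseView s
  ... | []            = inj₁ (trans (sym (++-identityʳ a)) (sym eq))
  ... | s₀ ∶ _ ∶ʳ x = inj₂ (s₀ , ∷ʳ-injectiveˡ g (a ++ s₀) (trans eq (sym (++-assoc a s₀ (x ∷ [])))))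

module _ (F : ETLFrame) (equiv : IsEquivalenceOnH F) where
  open ETLFrame F

  private
    ∼-sym : {a b : History E} → a ∼ b → b ∼ a
    ∼-sym = proj₁ (proj₂ equiv) _ _

    ∼-trans : {a b c : History E} → a ∼ b → b ∼ c → a ∼ c
    ∼-trans = proj₂ (proj₂ equiv) _ _ _

  module _ (hc : PR-hc F) where

    PR-hc-⇝* : {a c b : History E} → a ⇝* c → c ∼ b → ∃[ b' ] (a ∼ b' × b' ⇝* b)
    PR-hc-⇝* (s , refl) = go s
      where
      go : {a b : History E} (s : History E) → (a ++ s) ∼ b → ∃[ b' ] (a ∼ b' × b' ⇝* b)
      go {a} {b} [] as∼b = b , subst (_∼ b) (++-identityʳ a) as∼b , ⇝*-refl b
      go {a} (x ∷ s) as∼b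
        with b'' , ax∼b'' , b''⇝*b ← go s (subst (_∼ _) (sym (++-assoc a (x ∷ []) s)) as∼b)
        with b' , _ , a∼b' , b'⇝*b'' ← hc a x b'' ax∼b''
        = b' , a∼b' , ⇝*-trans b'⇝*b'' b''⇝*b

    ∼-convex : {a b c : History E} → a ⇝* b → b ⇝* c → a ∼ c → a ∼ b
    ∼-convex {c = c} = go (reverseView c)
      where
      go : {a b c : History E} → Reverse c → a ⇝* b → b ⇝* c → a ∼ c → a ∼ b
      go [] _ b⇝*c a∼c = subst (_ ∼_) (sym (⇝*-[] b⇝*c)) a∼c
      go {a} (c₀ ∶ rc ∶ʳ e) a⇝*b b⇝*c a∼c with ⇝*-∷ʳ b⇝*c
      ... | inj₁ refl = a∼c
      ... | inj₂ b⇝*c₀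
        with a' , _ , c₀∼a' , a'⇝*a ← hc c₀ e a (∼-sym a∼c)
        = go rc a⇝*b b⇝*c₀ a∼c₀
        where
        -- a' ⇝* a ⇝* c₀ with a' ∼ c₀, so convexity one step down gives a' ∼ a.
        a∼c₀ : a ∼ c₀
        a∼c₀ = ∼-trans (∼-sym (go rc a'⇝*a (⇝*-trans a⇝*b b⇝*c₀) (∼-sym c₀∼a'))) (∼-sym c₀∼a')

    PR-hc⇒PR-hcℓ : PR-hcℓ F
    PR-hc⇒PR-hcℓ h e h' he∼h'
      with m , _ , h∼m , m⇝*h' ← hc h e h' he∼h'
      with reverseView h'
    ... | [] = inj₁ (subst (h ∼_) (⇝*-[] m⇝*h') h∼m)
    ... | g ∶ _ ∶ʳ x with ⇝*-∷ʳ m⇝*h'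
    ...   | inj₁ refl = inj₁ h∼m
    ...   | inj₂ m⇝*g
      with k , _ , g∼k , k⇝*he ← hc g x (h ∷ʳ e) (∼-sym he∼h')
      with ⇝*-∷ʳ k⇝*he
    ...   | inj₁ refl = inj₂ (inj₂ (g , proj₁ (∼⊆H×H g k g∼k) , ∼-sym g∼k , x , refl))
    ...   | inj₂ k⇝*h
      with k' , m∼k' , k'⇝*k ← PR-hc-⇝* m⇝*g g∼k
      = inj₂ (inj₁ (g , proj₁ (∼⊆H×H g k g∼k) , ∼-trans h∼k (∼-sym g∼k) , x , refl))
      where
      h∼k' : h ∼ k'
      h∼k' = ∼-trans h∼m m∼k'

      h∼k : h ∼ k
      h∼k = ∼-trans h∼k' (∼-convex k'⇝*k k⇝*h (∼-sym h∼k'))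

  PR-hcℓ⇒PR-hc : PR-hcℓ F → PR-hc F
  PR-hcℓ⇒PR-hc hcℓ h e h' = go (reverseView h')
    where
    go : {h' : History E} → Reverse h' → (h ∷ʳ e) ∼ h' → ∃[ h'' ] (H h'' × h ∼ h'' × h'' ⇝* h')
    go {h'} _ he∼h' with hcℓ h e h' he∼h'
    ... | inj₁ h∼h' = h' , proj₂ (∼⊆H×H h h' h∼h') , h∼h' , ⇝*-refl h'
    ... | inj₂ (inj₁ (g , Hg , h∼g , g⇝h')) = g , Hg , h∼g , ⇝⇒⇝* g⇝h'
    go [] _ | inj₂ (inj₂ ([] , _ , _ , _ , ()))
    go [] _ | inj₂ (inj₂ (_ ∷ _ , _ , _ , _ , ()))
    go (g₀ ∶ rg ∶ʳ y) _ | inj₂ (inj₂ (g , _ , he∼g , x , eq)) with refl ← ∷ʳ-injectiveˡ g₀ g eq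
      with k , Hk , h∼k , k⇝*g ← go rg he∼g
      = k , Hk , h∼k , ⇝*-trans k⇝*g (y ∷ [] , refl)

proposition5 : (F : ETLFrame) → IsEquivalenceOnH F → (PR-hc F ⇔ PR-hcℓ F)
proposition5 F equiv = mk⇔ (PR-hc⇒PR-hcℓ F equiv) (PR-hcℓ⇒PR-hc F equiv)
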